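{- For $n\ge2$ define polynomials $B_n(t,x)$ by $B_2(t,x)=tx(1-x)^2$ and $B_{n+1}(t,x)=tx^{n+1}B_n(t,x)+tx(1-x)^n(1-x^n)$. Then $$S(12\cdots n;t,x)=\frac{t^n x^{\binom{n+1}{2}}}{(1-x)^n-B_n(t,x)}.$$
   Context: $\mathbb{P}$ is the positive integers; $\mathbb{P}^*$ the finite words over $\mathbb{P}$. Generalized factor order: $u\le w$ iff there is a factor $w'$ of $w$ (consecutive letters) with $|w'|=|u|$ and $u_i\le w'_i$ for all $i$; such $w'$ is an embedding. $\mathcal{S}(u)$ is the set of $w\ge u$ such that every embedding of $u$ into $w$ is a suffix of $w$. The weight of $w=w_1\cdots w_\ell$ is $t^\ell x^{w_1+\cdots+w_\ell}$, and $S(u;t,x)=\sum_{w\in\mathcal{S}(u)}\mathrm{wt}(w)$. $12\cdots n$ is the word with letters $1,2,\ldots,n$ in increasing order. -}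

module Defs where

open import Data.Nat using (ℕ; zero; suc; _+_; _≤_; _<_; _≟_; _≤?_; s≤s)
open import Data.Nat.Properties using (anyUpTo?; allUpTo?; ≤-trans; m≤m+n; ≤-pred)
open import Data.Integer as ℤ using (ℤ; +_)
open import Data.List using (List; []; _∷_; [_]; length; take; drop; map; concatMap; upTo; filter)
open import Data.Nat.ListAction using (sum)
open import Data.List.Relation.Binary.Pointwise using (Pointwise)
open import Data.List.Relation.Binary.Pointwise.Properties using (decidable)
open import Data.Product using (Σ; ∃; ∃-syntax; _×_; _,_; proj₁; proj₂)
open import Relation.Binary.PropositionalEquality using (_≡_)
open import Relation.Nullary using (Dec; yes; no; ¬_)
open import Relation.Nullary.Decidable using (_×-dec_; _→-dec_)

Word : Set
Word = List ℕ

-- u embeds into w at (0-based) position i: the factor w' = w_{i+1} ... w_{i+|u|}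
-- of w exists (i + |u| ≤ |w|) and u_k ≤ w'_k for every k.
EmbedsAt : Word → Word → ℕ → Set
EmbedsAt u w i = (i + length u ≤ length w) × Pointwise _≤_ u (take (length u) (drop i w))

_≼_ : Word → Word → Set
u ≼ w = ∃[ i ] EmbedsAt u w i

-- w ∈ 𝒮(u): u ≤ w and every embedding of u into w is a suffix of w
InS : Word → Word → Set
InS u w = (u ≼ w) × (∀ i → EmbedsAt u w i → i + length u ≡ length w)

-- decidability (needed only to count elements)
EmbedsAt? : ∀ u w i → Dec (EmbedsAt u w i)
EmbedsAt? u w i = (i + length u ≤? length w) ×-dec decidable _≤?_ u (take (length u) (drop i w))

private
  bound : ∀ {u w i} → EmbedsAt u w i → i < suc (length w)
  bound {u} {w} {i} (le , _) = s≤s (≤-trans (m≤m+n i (length u)) le)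

≼? : ∀ u w → Dec (u ≼ w)
≼? u w with anyUpTo? (EmbedsAt? u w) (suc (length w))
... | yes (i , _ , e) = yes (i , e)
... | no ¬p = no λ { (i , e) → ¬p (i , bound e , e) }

InS? : ∀ u w → Dec (InS u w)
InS? u w = ≼? u w ×-dec all
  where
  all : Dec (∀ i → EmbedsAt u w i → i + length u ≡ length w)
  all with allUpTo? (λ i → EmbedsAt? u w i →-dec (i + length u ≟ length w)) (suc (length w))
  ... | yes p = yes λ i e → p (bound e) e
  ... | no ¬p = no λ q → ¬p λ {i} _ → q i

-- all words of length ℓ with letters in {1,…,m}; every word over ℙ with
-- letter sum m has all its letters in {1,…,m}.
wordsUpTo : ℕ → ℕ → List Word
wordsUpTo zero    m = [ [] ]
wordsUpTo (suc ℓ) m = concatMap (λ a → map (a ∷_) (wordsUpTo ℓ m)) (map suc (upTo m))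

-- number of w ∈ 𝒮(u) of length ℓ and letter sum m
-- (= coefficient of t^ℓ x^m in S(u;t,x))
countS : Word → ℕ → ℕ → ℕ
countS u ℓ m = length (filter (λ w → (sum w ≟ m) ×-dec InS? u w) (wordsUpTo ℓ m))

-- Formal power series in t, x over ℤ, as coefficient functions:
-- f ℓ m is the coefficient of t^ℓ x^m.

Series : Set
Series = ℕ → ℕ → ℤ

S : Word → Series
S u ℓ m = + countS u ℓ m

0ˢ 1ˢ T X : Series
0ˢ _ _ = + 0
1ˢ zero zero = + 1
1ˢ _    _    = + 0
T (suc zero) zero = + 1
T _          _    = + 0
X zero (suc zero) = + 1
X _    _          = + 0

mono : ℕ → ℕ → Series
mono p q ℓ m with p ≟ ℓ | q ≟ m
... | yes _ | yes _ = + 1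
... | _     | _     = + 0

infixl 6 _⊕_ _⊖_
infixl 7 _⊗_
infixr 8 _^ˢ_

_⊕_ _⊖_ _⊗_ : Series → Series → Series
(f ⊕ g) ℓ m = f ℓ m ℤ.+ g ℓ m
(f ⊖ g) ℓ m = f ℓ m ℤ.- g ℓ m
(f ⊗ g) ℓ m = sumℤ (map (λ i → sumℤ (map (λ j → f i j ℤ.* g (ℓ ∸ i) (m ∸ j)) (upTo (suc m)))) (upTo (suc ℓ)))
  where
  open import Data.Nat using (_∸_)
  sumℤ : List ℤ → ℤ
  sumℤ = Data.List.foldr ℤ._+_ (+ 0)

_^ˢ_ : Series → ℕ → Series
f ^ˢ zero  = 1ˢ
f ^ˢ suc k = f ⊗ f ^ˢ k

-- B_n(t,x) for n ≥ 2 (values at n = 0,1 are irrelevant junk):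
-- B_2 = t x (1-x)^2,  B_{n+1} = t x^{n+1} B_n + t x (1-x)^n (1 - x^n)
B : ℕ → Series
B zero = 0ˢ
B (suc zero) = 0ˢ
B (suc (suc zero)) = T ⊗ X ⊗ (1ˢ ⊖ X) ^ˢ 2
B (suc n@(suc (suc _))) =
  T ⊗ X ^ˢ suc n ⊗ B n ⊕ T ⊗ X ⊗ (1ˢ ⊖ X) ^ˢ n ⊗ (1ˢ ⊖ X ^ˢ n)

incr : ℕ → Word
incr n = map suc (upTo n)

module Submission where

-- A word w lies in 𝒮(12⋯n) iff the automaton whose state after a prefix of w is the length
-- of the longest staircase 12⋯j ending there reaches state n for the first time at the end
-- of w. Reading a letter a in state d leads to state min(d + 1, a). Let C_d be the
-- generating function of the words which, read from state d, first reach state n at their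
-- end; then C_n = 1 and S(12⋯n) = C_0. Splitting off the first letter i + 1 gives
-- C_d = Σ_i t x^(i+1) C_(min(d,i)+1), so that (1 - x) C_0 = t x C_1 and
-- (1 - x)(C_(e+1) - C_e) = t x^(e+2) (C_(e+2) - C_(e+1)). Eliminating C_1, …, C_(n-1) yields
-- C_0 · D_n = t^n x^(n+1 choose 2) · C_n, where D_0 = 1,
-- D_(d+1) = t x^(d+1) D_d + (1 - x - t x)(1 - x)^d, and D_n = (1 - x)^n - B_n for n ≥ 2.

open import Defs
open import Level using (0ℓ)
open import Algebra using (CommutativeRing; IsCommutativeRing; RawRing)
open import Data.Bool using (Bool; true; false; _∧_; if_then_else_) renaming (T to Tᵇ)
open import Data.Bool.Properties using (T-∧; ∧-zeroʳ)
open import Data.Integer using (ℤ; +_)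
import Data.Integer as ℤ
import Data.Integer.Properties as ℤ
open import Data.Integer.Solver using (module +-*-Solver)
open import Data.List
  using (List; []; _∷_; _++_; take; drop; foldr; map; concatMap; applyUpTo; upTo; length; filter)
open import Data.List.Properties
  using (map-applyUpTo; map-cong; map-upTo; length-map; length-upTo; length-applyUpTo)
open import Data.List.Relation.Binary.Pointwise using (Pointwise; []; _∷_)
open import Data.Maybe using (Maybe; just; nothing)
open import Data.Nat as ℕ using (ℕ; zero; suc; _∸_; _≤_; _⊓_; _≡ᵇ_; _<ᵇ_; _≤ᵇ_)
import Data.Nat.Properties as ℕₚ
open import Data.Nat.Combinatorics using (_C_; nC1≡n; nCk+nC[k+1]≡[n+1]C[k+1])
open import Data.Nat.ListAction using (sum)
open import Data.Product using (_×_; _,_; proj₁; proj₂)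
open import Data.Sum using (inj₁; inj₂)
open import Data.Unit using (tt)
open import Function using (id; _∘_; _∘′_)
open import Function.Bundles using (Equivalence; _⇔_; mk⇔)
open import Relation.Binary.Definitions using (tri<; tri≈; tri>)
open import Relation.Binary.PropositionalEquality as ≡ using (_≡_; _≢_; _≗_)
open import Relation.Nullary using (Dec; yes; no; does; ¬_; contradiction)
open import Relation.Nullary.Decidable using (dec-true; dec-false)
open import Relation.Unary using (Pred; Decidable)
open import Algebra.Properties.AbelianGroup ℤ.+-0-abelianGroup using (xyx⁻¹≈y)

private variable
  A E : Set

-- The elements of an abstract ring cannot serve as the solver's coefficients: 1# * 1# does not
-- compute, so the two normal forms would not agree by refl. Integers, written as differences
-- a - b of naturals, do compute.
module IntegerCoefficientSolver {c ℓ} (R : CommutativeRing c ℓ) where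
  open CommutativeRing R
  open import Algebra.Properties.Ring ring
    using (x[y-z]≈xy-xz; [y-z]x≈yx-zx; -‿+-comm; -0#≈0#; ⁻¹-anti-homo‿-)
  open import Algebra.Properties.Semiring.Mult semiring
    using (×-homo-+; ×1-homo-*) renaming (_×_ to _·_)
  open import Algebra.Solver.Ring.AlmostCommutativeRing
    using (AlmostCommutativeRing; fromCommutativeRing; _-Raw-AlmostCommutative⟶_)
  open import Relation.Binary.Reasoning.Setoid setoid
  import Algebra.Solver.CommutativeMonoid +-commutativeMonoid as Monoid

  private
    Differences : RawRing 0ℓ 0ℓ
    Differences = record
      { Carrier = ℕ × ℕ ; _≈_ = _≡_
      ; _+_ = λ { (a , b) (c , d) → a ℕ.+ c , b ℕ.+ d }
      ; _*_ = λ { (a , b) (c , d) → a ℕ.* c ℕ.+ b ℕ.* d , a ℕ.* d ℕ.+ b ℕ.* c }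
      ; -_ = λ { (a , b) → b , a }
      ; 0# = 0 , 0 ; 1# = 1 , 0 }

    ι : ℕ → Carrier
    ι n = n · 1#

    ⟦_⟧ : ℕ × ℕ → Carrier
    ⟦ a , b ⟧ = ι a - ι b

    +-interchange-− : ∀ x y z w → (x + y) - (z + w) ≈ (x - z) + (y - w)
    +-interchange-− x y z w = begin
      (x + y) - (z + w)      ≈⟨ +-congˡ (-‿+-comm z w) ⟨
      (x + y) + (- z + - w)  ≈⟨ Monoid.solve 4 (λ x y z w → (x ∙ y) ∙ (z ∙ w) ⊜ (x ∙ z) ∙ (y ∙ w))
                                  refl x y (- z) (- w) ⟩
      (x - z) + (y - w)      ∎
      where open Monoid using (_⊜_) renaming (_⊕_ to _∙_)

    x-x+y≈y : ∀ x y → (x - x) + y ≈ y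
    x-x+y≈y x y = trans (+-congʳ (-‿inverseʳ x)) (+-identityˡ y)

    ι-homo-*+* : ∀ a b c d → ι (a ℕ.* c ℕ.+ b ℕ.* d) ≈ ι a * ι c + ι b * ι d
    ι-homo-*+* a b c d =
      trans (×-homo-+ 1# (a ℕ.* c) (b ℕ.* d)) (+-cong (×1-homo-* a c) (×1-homo-* b d))

    +-homo : ∀ a b c d → ⟦ a ℕ.+ c , b ℕ.+ d ⟧ ≈ ⟦ a , b ⟧ + ⟦ c , d ⟧
    +-homo a b c d = trans (+-cong (×-homo-+ 1# a c) (-‿cong (×-homo-+ 1# b d)))
                           (+-interchange-− (ι a) (ι c) (ι b) (ι d))

    *-homo : ∀ a b c d →
             ⟦ a ℕ.* c ℕ.+ b ℕ.* d , a ℕ.* d ℕ.+ b ℕ.* c ⟧ ≈ ⟦ a , b ⟧ * ⟦ c , d ⟧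
    *-homo a b c d = begin
      ι (a ℕ.* c ℕ.+ b ℕ.* d) - ι (a ℕ.* d ℕ.+ b ℕ.* c)
        ≈⟨ +-cong (ι-homo-*+* a b c d) (-‿cong (trans (ι-homo-*+* a b d c) (+-comm _ _))) ⟩
      (ι a * ι c + ι b * ι d) - (ι b * ι c + ι a * ι d)
        ≈⟨ +-interchange-− (ι a * ι c) (ι b * ι d) (ι b * ι c) (ι a * ι d) ⟩
      (ι a * ι c - ι b * ι c) + (ι b * ι d - ι a * ι d)
        ≈⟨ +-congˡ (⁻¹-anti-homo‿- (ι a * ι d) (ι b * ι d)) ⟨
      (ι a * ι c - ι b * ι c) - (ι a * ι d - ι b * ι d)
        ≈⟨ +-cong ([y-z]x≈yx-zx (ι c) (ι a) (ι b)) (-‿cong ([y-z]x≈yx-zx (ι d) (ι a) (ι b))) ⟨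
      (ι a - ι b) * ι c - (ι a - ι b) * ι d
        ≈⟨ x[y-z]≈xy-xz (ι a - ι b) (ι c) (ι d) ⟨
      (ι a - ι b) * (ι c - ι d) ∎

    ⟦⟧-cong : ∀ a b c d → a ℕ.+ d ≡ c ℕ.+ b → ⟦ a , b ⟧ ≈ ⟦ c , d ⟧
    ⟦⟧-cong a b c d a+d≡c+b = begin
      ι a - ι b                  ≈⟨ x-x+y≈y (ι d) (ι a - ι b) ⟨
      (ι d - ι d) + (ι a - ι b)  ≈⟨ +-comm _ _ ⟩
      (ι a - ι b) + (ι d - ι d)  ≈⟨ +-interchange-− (ι a) (ι d) (ι b) (ι d) ⟨
      (ι a + ι d) - (ι b + ι d)  ≈⟨ +-cong ι[a+d]≈ι[c+b] (-‿cong (+-comm (ι b) (ι d))) ⟩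
      (ι c + ι b) - (ι d + ι b)  ≈⟨ +-interchange-− (ι c) (ι b) (ι d) (ι b) ⟩
      (ι c - ι d) + (ι b - ι b)  ≈⟨ +-comm _ _ ⟩
      (ι b - ι b) + (ι c - ι d)  ≈⟨ x-x+y≈y (ι b) (ι c - ι d) ⟩
      ι c - ι d                  ∎
      where
      ι[a+d]≈ι[c+b] : ι a + ι d ≈ ι c + ι b
      ι[a+d]≈ι[c+b] =
        trans (sym (×-homo-+ 1# a d)) (trans (reflexive (≡.cong ι a+d≡c+b)) (×-homo-+ 1# c b))

    R′ : AlmostCommutativeRing c ℓ
    R′ = fromCommutativeRing R

    ⟦⟧-homomorphism : Differences -Raw-AlmostCommutative⟶ R′
    ⟦⟧-homomorphism = record
      { ⟦_⟧ = ⟦_⟧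
      ; +-homo = λ { (a , b) (c , d) → +-homo a b c d }
      ; *-homo = λ { (a , b) (c , d) → *-homo a b c d }
      ; -‿homo = λ { (a , b) → sym (⁻¹-anti-homo‿- (ι a) (ι b)) }
      ; 0-homo = -‿inverseʳ 0#
      ; 1-homo = trans (+-congˡ -0#≈0#) (trans (+-identityʳ _) (+-identityʳ 1#))
      }

    equal? : ∀ x y → Maybe (⟦ x ⟧ ≈ ⟦ y ⟧)
    equal? (a , b) (c , d) with a ℕ.+ d ℕ.≟ c ℕ.+ b
    ... | yes a+d≡c+b = just (⟦⟧-cong a b c d a+d≡c+b)
    ... | no _ = nothing

  open import Algebra.Solver.Ring Differences R′ ⟦⟧-homomorphism equal? public

-- Formal power series

module PowerSeries {c ℓ} (R : CommutativeRing c ℓ) where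
  open CommutativeRing R hiding (isCommutativeRing)
  open IntegerCoefficientSolver R using (solve; _:+_; _:*_; _:=_)
  open import Relation.Binary.Reasoning.Setoid setoid
  import Algebra.Construct.Pointwise ℕ as Lifted

  PowerSeries : Set c
  PowerSeries = ℕ → Carrier

  infix 4 _≋_
  infixl 6 _+ₚ_
  infixl 7 _⋆_

  _≋_ : PowerSeries → PowerSeries → Set ℓ
  f ≋ g = ∀ n → f n ≈ g n

  shift : PowerSeries → PowerSeries
  shift f n = f (suc n)

  0ₚ 1ₚ : PowerSeries
  0ₚ _ = 0#
  1ₚ zero = 1#
  1ₚ (suc _) = 0#

  _+ₚ_ : PowerSeries → PowerSeries → PowerSeries
  (f +ₚ g) n = f n + g n

  -ₚ_ : PowerSeries → PowerSeries
  (-ₚ f) n = - f n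

  scale : Carrier → PowerSeries → PowerSeries
  scale a f n = a * f n

  _⋆_ : PowerSeries → PowerSeries → PowerSeries
  (f ⋆ g) zero = f 0 * g 0
  (f ⋆ g) (suc n) = f 0 * g (suc n) + (shift f ⋆ g) n

  ⋆-cong : ∀ {f f′ g g′} → f ≋ f′ → g ≋ g′ → f ⋆ g ≋ f′ ⋆ g′
  ⋆-cong f≋f′ g≋g′ zero = *-cong (f≋f′ 0) (g≋g′ 0)
  ⋆-cong f≋f′ g≋g′ (suc n) =
    +-cong (*-cong (f≋f′ 0) (g≋g′ (suc n))) (⋆-cong (λ i → f≋f′ (suc i)) g≋g′ n)

  ⋆-zeroˡ : ∀ g → 0ₚ ⋆ g ≋ 0ₚ
  ⋆-zeroˡ g zero = zeroˡ (g 0)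
  ⋆-zeroˡ g (suc n) = trans (+-cong (zeroˡ (g (suc n))) (⋆-zeroˡ g n)) (+-identityˡ 0#)

  ⋆-identityˡ : ∀ g → 1ₚ ⋆ g ≋ g
  ⋆-identityˡ g zero = *-identityˡ (g 0)
  ⋆-identityˡ g (suc n) =
    trans (+-cong (*-identityˡ (g (suc n))) (⋆-zeroˡ g n)) (+-identityʳ _)

  ⋆-scaleˡ : ∀ a f g → scale a f ⋆ g ≋ scale a (f ⋆ g)
  ⋆-scaleˡ a f g zero = *-assoc a (f 0) (g 0)
  ⋆-scaleˡ a f g (suc n) = begin
    a * f 0 * g (suc n) + (scale a (shift f) ⋆ g) n
      ≈⟨ +-cong (*-assoc a (f 0) (g (suc n))) (⋆-scaleˡ a (shift f) g n) ⟩
    a * (f 0 * g (suc n)) + a * (shift f ⋆ g) n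
      ≈⟨ distribˡ a _ _ ⟨
    a * (f 0 * g (suc n) + (shift f ⋆ g) n) ∎

  ⋆-distribʳ : ∀ h f g → (f +ₚ g) ⋆ h ≋ f ⋆ h +ₚ g ⋆ h
  ⋆-distribʳ h f g zero = distribʳ (h 0) (f 0) (g 0)
  ⋆-distribʳ h f g (suc n) = begin
    (f 0 + g 0) * h (suc n) + ((shift f +ₚ shift g) ⋆ h) n
      ≈⟨ +-congˡ (⋆-distribʳ h (shift f) (shift g) n) ⟩
    (f 0 + g 0) * h (suc n) + ((shift f ⋆ h) n + (shift g ⋆ h) n)
      ≈⟨ solve 5 (λ a b c x y → (a :+ b) :* c :+ (x :+ y) := (a :* c :+ x) :+ (b :* c :+ y))
           refl (f 0) (g 0) (h (suc n)) ((shift f ⋆ h) n) ((shift g ⋆ h) n) ⟩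
    (f 0 * h (suc n) + (shift f ⋆ h) n) + (g 0 * h (suc n) + (shift g ⋆ h) n) ∎

  ⋆-unfoldʳ : ∀ f g n → (f ⋆ g) (suc n) ≈ f (suc n) * g 0 + (f ⋆ shift g) n
  ⋆-unfoldʳ f g zero = +-comm _ _
  ⋆-unfoldʳ f g (suc n) = begin
    f 0 * g (suc (suc n)) + (shift f ⋆ g) (suc n)
      ≈⟨ +-congˡ (⋆-unfoldʳ (shift f) g n) ⟩
    f 0 * g (suc (suc n)) + (f (suc (suc n)) * g 0 + (shift f ⋆ shift g) n)
      ≈⟨ solve 3 (λ a b c → a :+ (b :+ c) := b :+ (a :+ c))
           refl (f 0 * g (suc (suc n))) (f (suc (suc n)) * g 0) ((shift f ⋆ shift g) n) ⟩
    f (suc (suc n)) * g 0 + (f 0 * g (suc (suc n)) + (shift f ⋆ shift g) n) ∎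

  ⋆-comm : ∀ f g → f ⋆ g ≋ g ⋆ f
  ⋆-comm f g zero = *-comm (f 0) (g 0)
  ⋆-comm f g (suc n) =
    trans (+-cong (*-comm (f 0) (g (suc n))) (⋆-comm (shift f) g n)) (sym (⋆-unfoldʳ g f n))

  ⋆-assoc : ∀ f g h → (f ⋆ g) ⋆ h ≋ f ⋆ (g ⋆ h)
  ⋆-assoc f g h zero = *-assoc (f 0) (g 0) (h 0)
  ⋆-assoc f g h (suc n) = begin
    f 0 * g 0 * h (suc n) + ((scale (f 0) (shift g) +ₚ shift f ⋆ g) ⋆ h) n
      ≈⟨ +-congˡ (⋆-distribʳ h (scale (f 0) (shift g)) (shift f ⋆ g) n) ⟩
    f 0 * g 0 * h (suc n) + ((scale (f 0) (shift g) ⋆ h) n + ((shift f ⋆ g) ⋆ h) n)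
      ≈⟨ +-congˡ (+-cong (⋆-scaleˡ (f 0) (shift g) h n) (⋆-assoc (shift f) g h n)) ⟩
    f 0 * g 0 * h (suc n) + (f 0 * (shift g ⋆ h) n + (shift f ⋆ (g ⋆ h)) n)
      ≈⟨ solve 5 (λ a b c x y → a :* b :* c :+ (a :* x :+ y) := a :* (b :* c :+ x) :+ y)
           refl (f 0) (g 0) (h (suc n)) ((shift g ⋆ h) n) ((shift f ⋆ (g ⋆ h)) n) ⟩
    f 0 * (g 0 * h (suc n) + (shift g ⋆ h) n) + (shift f ⋆ (g ⋆ h)) n ∎

  isCommutativeRing : IsCommutativeRing _≋_ _+ₚ_ _⋆_ -ₚ_ 0ₚ 1ₚ
  isCommutativeRing = record
    { isRing = record
      { +-isAbelianGroup = Lifted.isAbelianGroup +-isAbelianGroup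
      ; *-cong = ⋆-cong
      ; *-assoc = ⋆-assoc
      ; *-identity = ⋆-identityˡ , λ g n → trans (⋆-comm g 1ₚ n) (⋆-identityˡ g n)
      ; distrib = (λ h f g n → trans (⋆-comm h (f +ₚ g) n)
                     (trans (⋆-distribʳ h f g n) (+-cong (⋆-comm f h n) (⋆-comm g h n))))
                , ⋆-distribʳ
      }
    ; *-comm = ⋆-comm
    }

  commutativeRing : CommutativeRing c ℓ
  commutativeRing = record { isCommutativeRing = isCommutativeRing }

  Σ : List Carrier → Carrier
  Σ = foldr _+_ 0#

  ⋆-as-sum : ∀ f g n → Σ (map (λ i → f i * g (n ∸ i)) (upTo (suc n))) ≈ (f ⋆ g) n
  ⋆-as-sum f g n = trans (reflexive (≡.cong Σ (map-applyUpTo id _ (suc n)))) (Σ-applyUpTo f n)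
    where
    Σ-applyUpTo : ∀ f n → Σ (applyUpTo (λ i → f i * g (n ∸ i)) (suc n)) ≈ (f ⋆ g) n
    Σ-applyUpTo f zero = +-identityʳ _
    Σ-applyUpTo f (suc n) = +-congˡ (Σ-applyUpTo (shift f) n)

  IsIndeterminate : PowerSeries → Set ℓ
  IsIndeterminate f = f 0 ≈ 0# × shift f ≋ 1ₚ

  indeterminate-⋆ : ∀ f g → IsIndeterminate f → (f ⋆ g) 0 ≈ 0# × shift (f ⋆ g) ≋ g
  indeterminate-⋆ f g (f₀≈0 , shift-f≋1) =
    trans (*-congʳ f₀≈0) (zeroˡ (g 0)) ,
    λ n → trans (+-cong (trans (*-congʳ f₀≈0) (zeroˡ _))
                        (trans (⋆-cong shift-f≋1 (λ _ → refl) n) (⋆-identityˡ g n)))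
                (+-identityˡ _)

  constant-⋆ : ∀ f g → (∀ n → f (suc n) ≈ 0#) → f ⋆ g ≋ scale (f 0) g
  constant-⋆ f g f≈0 zero = refl
  constant-⋆ f g f≈0 (suc n) =
    trans (+-congˡ (trans (⋆-cong f≈0 (λ _ → refl) n) (⋆-zeroˡ g n))) (+-identityʳ _)

module ℤ[[x]] = PowerSeries ℤ.+-*-commutativeRing
module ℤ[[x]][[t]] = PowerSeries ℤ[[x]].commutativeRing

open ℤ[[x]][[t]] using (_⋆_)

-- Series is definitionally ℤ[[x]][[t]].PowerSeries, with _≈ˢ_ as its equality _≋_.
infix 4 _≈ˢ_

_≈ˢ_ : Series → Series → Set
f ≈ˢ g = ∀ ℓ m → f ℓ m ≡ g ℓ m

Σ-at : ∀ (h : A → ℤ[[x]].PowerSeries) xs m →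
       ℤ[[x]][[t]].Σ (map h xs) m ≡ ℤ[[x]].Σ (map (λ a → h a m) xs)
Σ-at h [] m = ≡.refl
Σ-at h (a ∷ xs) m = ≡.cong (ℤ._+_ (h a m)) (Σ-at h xs m)

⊗≈⋆ : ∀ F G → F ⊗ G ≈ˢ F ⋆ G
⊗≈⋆ F G ℓ m = begin
  (F ⊗ G) ℓ m
    ≡⟨ ≡.cong ℤ[[x]].Σ (map-cong (λ i → ℤ[[x]].⋆-as-sum (F i) (G (ℓ ∸ i)) m) (upTo (suc ℓ))) ⟩
  ℤ[[x]].Σ (map (λ i → (F i ℤ[[x]].⋆ G (ℓ ∸ i)) m) (upTo (suc ℓ)))
    ≡⟨ Σ-at (λ i → F i ℤ[[x]].⋆ G (ℓ ∸ i)) (upTo (suc ℓ)) m ⟨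
  ℤ[[x]][[t]].Σ (map (λ i → F i ℤ[[x]].⋆ G (ℓ ∸ i)) (upTo (suc ℓ))) m
    ≡⟨ ℤ[[x]][[t]].⋆-as-sum F G ℓ m ⟩
  (F ⋆ G) ℓ m ∎
  where open ≡.≡-Reasoning

⋆≈⇒⊗≈ : ∀ {F G F′ G′} → F ⋆ G ≈ˢ F′ ⋆ G′ → F ⊗ G ≈ˢ F′ ⊗ G′
⋆≈⇒⊗≈ {F} {G} {F′} {G′} eq ℓ m =
  ≡.trans (⊗≈⋆ F G ℓ m) (≡.trans (eq ℓ m) (≡.sym (⊗≈⋆ F′ G′ ℓ m)))

1ˢ≈1ₚ : 1ˢ ≈ˢ ℤ[[x]][[t]].1ₚ
1ˢ≈1ₚ zero zero = ≡.refl
1ˢ≈1ₚ zero (suc m) = ≡.refl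
1ˢ≈1ₚ (suc ℓ) m = ≡.refl

⊗-cong : ∀ {F F′ G G′} → F ≈ˢ F′ → G ≈ˢ G′ → F ⊗ G ≈ˢ F′ ⊗ G′
⊗-cong F≈F′ G≈G′ = ⋆≈⇒⊗≈ (ℤ[[x]][[t]].⋆-cong F≈F′ G≈G′)

⊗-comm : ∀ F G → F ⊗ G ≈ˢ G ⊗ F
⊗-comm F G = ⋆≈⇒⊗≈ (ℤ[[x]][[t]].⋆-comm F G)

⊗-assoc : ∀ F G H → (F ⊗ G) ⊗ H ≈ˢ F ⊗ (G ⊗ H)
⊗-assoc F G H ℓ m = begin
  ((F ⊗ G) ⊗ H) ℓ m  ≡⟨ ⊗≈⋆ (F ⊗ G) H ℓ m ⟩
  ((F ⊗ G) ⋆ H) ℓ m  ≡⟨ ℤ[[x]][[t]].⋆-cong (⊗≈⋆ F G) (λ _ _ → ≡.refl) ℓ m ⟩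
  ((F ⋆ G) ⋆ H) ℓ m  ≡⟨ ℤ[[x]][[t]].⋆-assoc F G H ℓ m ⟩
  (F ⋆ (G ⋆ H)) ℓ m  ≡⟨ ℤ[[x]][[t]].⋆-cong {F} (λ _ _ → ≡.refl) (⊗≈⋆ G H) ℓ m ⟨
  (F ⋆ (G ⊗ H)) ℓ m  ≡⟨ ⊗≈⋆ F (G ⊗ H) ℓ m ⟨
  (F ⊗ (G ⊗ H)) ℓ m  ∎
  where open ≡.≡-Reasoning

⊗-identityˡ : ∀ G → 1ˢ ⊗ G ≈ˢ G
⊗-identityˡ G ℓ m = ≡.trans (⊗≈⋆ 1ˢ G ℓ m)
  (≡.trans (ℤ[[x]][[t]].⋆-cong 1ˢ≈1ₚ (λ _ _ → ≡.refl) ℓ m) (ℤ[[x]][[t]].⋆-identityˡ G ℓ m))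

⊗-distribʳ : ∀ H F G → (F ⊕ G) ⊗ H ≈ˢ F ⊗ H ⊕ G ⊗ H
⊗-distribʳ H F G ℓ m = ≡.trans (⊗≈⋆ (F ⊕ G) H ℓ m)
  (≡.trans (ℤ[[x]][[t]].⋆-distribʳ H F G ℓ m)
           (≡.sym (≡.cong₂ ℤ._+_ (⊗≈⋆ F H ℓ m) (⊗≈⋆ G H ℓ m))))

⊝_ : Series → Series
(⊝ f) ℓ m = ℤ.- f ℓ m

isCommutativeRing : IsCommutativeRing _≈ˢ_ _⊕_ _⊗_ ⊝_ 0ˢ 1ˢ
isCommutativeRing = record
  { isRing = record
    { +-isAbelianGroup = IsCommutativeRing.+-isAbelianGroup ℤ[[x]][[t]].isCommutativeRing
    ; *-cong = ⊗-cong
    ; *-assoc = ⊗-assoc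
    ; *-identity = ⊗-identityˡ , λ G ℓ m → ≡.trans (⊗-comm G 1ˢ ℓ m) (⊗-identityˡ G ℓ m)
    ; distrib = (λ H F G ℓ m → ≡.trans (⊗-comm H (F ⊕ G) ℓ m) (≡.trans (⊗-distribʳ H F G ℓ m)
                   (≡.cong₂ ℤ._+_ (⊗-comm F H ℓ m) (⊗-comm G H ℓ m))))
              , ⊗-distribʳ
    }
  ; *-comm = ⊗-comm
  }

seriesRing : CommutativeRing 0ℓ 0ℓ
seriesRing = record { isCommutativeRing = isCommutativeRing }

T-indeterminate : ℤ[[x]][[t]].IsIndeterminate T
T-indeterminate =
  (λ _ → ≡.refl) , λ { zero zero → ≡.refl ; zero (suc _) → ≡.refl ; (suc _) _ → ≡.refl }

X₀-indeterminate : ℤ[[x]].IsIndeterminate (X 0)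
X₀-indeterminate = ≡.refl , λ { zero → ≡.refl ; (suc _) → ≡.refl }

T⊗-zero : ∀ F m → (T ⊗ F) 0 m ≡ + 0
T⊗-zero F m = ≡.trans (⊗≈⋆ T F 0 m) (proj₁ (ℤ[[x]][[t]].indeterminate-⋆ T F T-indeterminate) m)

T⊗-suc : ∀ F ℓ m → (T ⊗ F) (suc ℓ) m ≡ F ℓ m
T⊗-suc F ℓ m =
  ≡.trans (⊗≈⋆ T F (suc ℓ) m) (proj₂ (ℤ[[x]][[t]].indeterminate-⋆ T F T-indeterminate) ℓ m)

X⊗≈X₀⋆ : ∀ F ℓ m → (X ⊗ F) ℓ m ≡ (X 0 ℤ[[x]].⋆ F ℓ) m
X⊗≈X₀⋆ F ℓ m = ≡.trans (⊗≈⋆ X F ℓ m) (ℤ[[x]][[t]].constant-⋆ X F (λ _ _ → ≡.refl) ℓ m)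

X⊗-zero : ∀ F ℓ → (X ⊗ F) ℓ 0 ≡ + 0
X⊗-zero F ℓ =
  ≡.trans (X⊗≈X₀⋆ F ℓ 0) (proj₁ (ℤ[[x]].indeterminate-⋆ (X 0) (F ℓ) X₀-indeterminate))

X⊗-suc : ∀ F ℓ m → (X ⊗ F) ℓ (suc m) ≡ F ℓ m
X⊗-suc F ℓ m =
  ≡.trans (X⊗≈X₀⋆ F ℓ (suc m)) (proj₂ (ℤ[[x]].indeterminate-⋆ (X 0) (F ℓ) X₀-indeterminate) m)

[_≤_]·_ : ℕ → ℕ → ℤ → ℤ
[ zero  ≤ m     ]· z = z
[ suc k ≤ zero  ]· z = + 0
[ suc k ≤ suc m ]· z = [ k ≤ m ]· z

[≤]·0 : ∀ k m → [ k ≤ m ]· (+ 0) ≡ + 0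
[≤]·0 zero m = ≡.refl
[≤]·0 (suc k) zero = ≡.refl
[≤]·0 (suc k) (suc m) = [≤]·0 k m

Xᵏ⊗ : ∀ k H ℓ m → (X ^ˢ k ⊗ H) ℓ m ≡ [ k ≤ m ]· H ℓ (m ∸ k)
Xᵏ⊗ zero H ℓ m = ⊗-identityˡ H ℓ m
Xᵏ⊗ (suc k) H ℓ zero = ≡.trans (⊗-assoc X (X ^ˢ k) H ℓ 0) (X⊗-zero (X ^ˢ k ⊗ H) ℓ)
Xᵏ⊗ (suc k) H ℓ (suc m) =
  ≡.trans (⊗-assoc X (X ^ˢ k) H ℓ (suc m)) (≡.trans (X⊗-suc (X ^ˢ k ⊗ H) ℓ m) (Xᵏ⊗ k H ℓ m))

TXᵏ⊗-zero : ∀ k H m → (T ⊗ X ^ˢ k ⊗ H) 0 m ≡ + 0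
TXᵏ⊗-zero k H m = ≡.trans (⊗-assoc T (X ^ˢ k) H 0 m) (T⊗-zero (X ^ˢ k ⊗ H) m)

TXᵏ⊗-suc : ∀ k H ℓ m → (T ⊗ X ^ˢ k ⊗ H) (suc ℓ) m ≡ [ k ≤ m ]· H ℓ (m ∸ k)
TXᵏ⊗-suc k H ℓ m =
  ≡.trans (⊗-assoc T (X ^ˢ k) H (suc ℓ) m) (≡.trans (T⊗-suc (X ^ˢ k ⊗ H) ℓ m) (Xᵏ⊗ k H ℓ m))

open import Data.Nat using (_+_)

sumℤ : List ℤ → ℤ
sumℤ = foldr ℤ._+_ (+ 0)

+-sum : ∀ ns → + sum ns ≡ sumℤ (map +_ ns)
+-sum [] = ≡.refl
+-sum (n ∷ ns) = ≡.trans (ℤ.pos-+ n (sum ns)) (≡.cong (ℤ._+_ (+ n)) (+-sum ns))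

applyUpTo-cong : ∀ m {f g : ℕ → A} → (∀ i → i ℕ.< m → f i ≡ g i) → applyUpTo f m ≡ applyUpTo g m
applyUpTo-cong zero f≡g = ≡.refl
applyUpTo-cong (suc m) f≡g =
  ≡.cong₂ _∷_ (f≡g 0 (ℕ.s≤s ℕ.z≤n)) (applyUpTo-cong m (λ i i<m → f≡g (suc i) (ℕ.s≤s i<m)))

sum-applyUpTo-cong : ∀ m {f g : ℕ → ℕ} → (∀ i → i ℕ.< m → f i ≡ g i) →
                     sum (applyUpTo f m) ≡ sum (applyUpTo g m)
sum-applyUpTo-cong m f≡g = ≡.cong sum (applyUpTo-cong m f≡g)

sum-applyUpTo-truncate : ∀ {M m} f → m ℕ.≤ M → (∀ i → m ℕ.≤ i → f i ≡ 0) →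
                         sum (applyUpTo f M) ≡ sum (applyUpTo f m)
sum-applyUpTo-truncate {M} {zero} f _ f≡0 = sum≡0 M f (λ i → f≡0 i ℕ.z≤n)
  where
  sum≡0 : ∀ M f → (∀ i → f i ≡ 0) → sum (applyUpTo f M) ≡ 0
  sum≡0 zero f f≡0 = ≡.refl
  sum≡0 (suc M) f f≡0 = ≡.cong₂ ℕ._+_ (f≡0 0) (sum≡0 M (f ∘′ suc) (λ i → f≡0 (suc i)))
sum-applyUpTo-truncate {suc M} {suc m} f (ℕ.s≤s m≤M) f≡0 =
  ≡.cong (f 0 ℕ.+_) (sum-applyUpTo-truncate (f ∘′ suc) m≤M (λ i m≤i → f≡0 (suc i) (ℕ.s≤s m≤i)))

sumℤ-applyUpTo-− : ∀ m (f g : ℕ → ℤ) →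
                   sumℤ (applyUpTo f m) ℤ.- sumℤ (applyUpTo g m) ≡ sumℤ (applyUpTo (λ i → f i ℤ.- g i) m)
sumℤ-applyUpTo-− zero f g = ≡.refl
sumℤ-applyUpTo-− (suc m) f g = ≡.trans
  (solve 4 (λ x y z w → (x :+ y) :- (z :+ w) := (x :- z) :+ (y :- w)) ≡.refl
     (f 0) (sumℤ (applyUpTo (f ∘′ suc) m)) (g 0) (sumℤ (applyUpTo (g ∘′ suc) m)))
  (≡.cong (ℤ._+_ (f 0 ℤ.- g 0)) (sumℤ-applyUpTo-− m (f ∘′ suc) (g ∘′ suc)))
  where open +-*-Solver

-- the coefficient of x^m in x^(d+1) h / (1 - x)
tailSum : ℕ → (ℕ → ℤ) → ℕ → ℤ
tailSum d h m = sumℤ (applyUpTo (λ i → [ d ≤ i ]· h (m ∸ suc i)) m)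

tailSum-suc : ∀ d h m → tailSum d h (suc m) ≡ tailSum d h m ℤ.+ [ d ≤ m ]· h (m ∸ d)
tailSum-suc zero h m = ℤ.+-comm (h m) (tailSum zero h m)
tailSum-suc (suc e) h zero = ≡.refl
tailSum-suc (suc e) h (suc m) = begin
  + 0 ℤ.+ tailSum e h (suc m)                       ≡⟨ ℤ.+-identityˡ _ ⟩
  tailSum e h (suc m)                               ≡⟨ tailSum-suc e h m ⟩
  tailSum e h m ℤ.+ last                            ≡⟨ ≡.cong (ℤ._+ last) (ℤ.+-identityˡ (tailSum e h m)) ⟨
  (+ 0 ℤ.+ tailSum e h m) ℤ.+ last                  ∎
  where
  open ≡.≡-Reasoning
  last = [ e ≤ m ]· h (m ∸ e)

Y : Series
Y = 1ˢ ⊖ X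

Y⊗-tailSum : ∀ d F H → (∀ m → F 0 m ≡ + 0) → (∀ ℓ m → F (suc ℓ) m ≡ tailSum d (H ℓ) m) →
             Y ⊗ F ≈ˢ T ⊗ X ^ˢ suc d ⊗ H
Y⊗-tailSum d F H F₀≡0 F-suc ℓ m = ≡.trans (Y⊗F≈F⊖X⊗F ℓ m) (coefficient ℓ m)
  where
  open IntegerCoefficientSolver seriesRing using (solve; _:-_; _:*_; _:^_; _:=_)

  Y⊗F≈F⊖X⊗F : Y ⊗ F ≈ˢ F ⊖ X ⊗ F
  Y⊗F≈F⊖X⊗F = solve 2 (λ x f → (x :^ 0 :- x) :* f := f :- x :* f) (λ _ _ → ≡.refl) X F

  coefficient : ∀ ℓ m → (F ⊖ X ⊗ F) ℓ m ≡ (T ⊗ X ^ˢ suc d ⊗ H) ℓ m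
  coefficient zero zero =
    ≡.trans (≡.cong₂ ℤ._-_ (F₀≡0 0) (X⊗-zero F 0)) (≡.sym (TXᵏ⊗-zero (suc d) H 0))
  coefficient zero (suc m) =
    ≡.trans (≡.cong₂ ℤ._-_ (F₀≡0 (suc m)) (≡.trans (X⊗-suc F 0 m) (F₀≡0 m)))
            (≡.sym (TXᵏ⊗-zero (suc d) H (suc m)))
  coefficient (suc ℓ) zero =
    ≡.trans (≡.cong₂ ℤ._-_ (F-suc ℓ 0) (X⊗-zero F (suc ℓ))) (≡.sym (TXᵏ⊗-suc (suc d) H ℓ 0))
  coefficient (suc ℓ) (suc m) = begin
    F (suc ℓ) (suc m) ℤ.- (X ⊗ F) (suc ℓ) (suc m)
      ≡⟨ ≡.cong₂ ℤ._-_ (≡.trans (F-suc ℓ (suc m)) (tailSum-suc d (H ℓ) m))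
                       (≡.trans (X⊗-suc F (suc ℓ) m) (F-suc ℓ m)) ⟩
    (tailSum d (H ℓ) m ℤ.+ [ d ≤ m ]· H ℓ (m ∸ d)) ℤ.- tailSum d (H ℓ) m
      ≡⟨ xyx⁻¹≈y (tailSum d (H ℓ) m) _ ⟩
    [ d ≤ m ]· H ℓ (m ∸ d)
      ≡⟨ TXᵏ⊗-suc (suc d) H ℓ (suc m) ⟨
    (T ⊗ X ^ˢ suc d ⊗ H) (suc ℓ) (suc m) ∎
    where open ≡.≡-Reasoning

-- The numerator t^n x^(n+1 choose 2)

wt-incr : ℕ → Series
wt-incr zero = 1ˢ
wt-incr (suc d) = T ⊗ X ^ˢ suc d ⊗ wt-incr d

𝟙 : Bool → ℤ
𝟙 true = + 1
𝟙 false = + 0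

≡ᵇ-refl : ∀ p → (p ≡ᵇ p) ≡ true
≡ᵇ-refl p = dec-true (p ℕ.≟ p) ≡.refl

≢⇒≡ᵇ-false : ∀ {p q} → p ≢ q → (p ≡ᵇ q) ≡ false
≢⇒≡ᵇ-false {p} {q} = dec-false (p ℕ.≟ q)

mono≡𝟙 : ∀ p q ℓ m → mono p q ℓ m ≡ 𝟙 ((p ≡ᵇ ℓ) ∧ (q ≡ᵇ m))
mono≡𝟙 p q ℓ m with p ℕ.≟ ℓ | q ℕ.≟ m
... | yes ≡.refl | yes ≡.refl rewrite ≡ᵇ-refl p | ≡ᵇ-refl q = ≡.refl
... | yes ≡.refl | no q≢m rewrite ≡ᵇ-refl p | ≢⇒≡ᵇ-false q≢m = ≡.refl
... | no p≢ℓ | _ rewrite ≢⇒≡ᵇ-false p≢ℓ = ≡.refl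

𝟙-∧-+≡ᵇ : ∀ c k q m → 𝟙 (c ∧ (k + q ≡ᵇ m)) ≡ [ k ≤ m ]· 𝟙 (c ∧ (q ≡ᵇ m ∸ k))
𝟙-∧-+≡ᵇ false k q m = ≡.sym ([≤]·0 k m)
𝟙-∧-+≡ᵇ true zero q m = ≡.refl
𝟙-∧-+≡ᵇ true (suc k) q zero = ≡.refl
𝟙-∧-+≡ᵇ true (suc k) q (suc m) = 𝟙-∧-+≡ᵇ true k q m

wt-incr≈mono : ∀ d → wt-incr d ≈ˢ mono d (suc d C 2)
wt-incr≈mono zero zero zero = ≡.refl
wt-incr≈mono zero zero (suc m) = ≡.refl
wt-incr≈mono zero (suc ℓ) m = ≡.refl
wt-incr≈mono (suc e) zero m =
  ≡.trans (TXᵏ⊗-zero (suc e) (wt-incr e) m) (≡.sym (mono≡𝟙 (suc e) (suc (suc e) C 2) 0 m))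
wt-incr≈mono (suc e) (suc ℓ) m = begin
  (T ⊗ X ^ˢ suc e ⊗ wt-incr e) (suc ℓ) m
    ≡⟨ TXᵏ⊗-suc (suc e) (wt-incr e) ℓ m ⟩
  [ suc e ≤ m ]· wt-incr e ℓ (m ∸ suc e)
    ≡⟨ ≡.cong ([ suc e ≤ m ]·_)
         (≡.trans (wt-incr≈mono e ℓ (m ∸ suc e)) (mono≡𝟙 e (suc e C 2) ℓ (m ∸ suc e))) ⟩
  [ suc e ≤ m ]· 𝟙 ((e ≡ᵇ ℓ) ∧ (suc e C 2 ≡ᵇ m ∸ suc e))
    ≡⟨ 𝟙-∧-+≡ᵇ (e ≡ᵇ ℓ) (suc e) (suc e C 2) m ⟨
  𝟙 ((e ≡ᵇ ℓ) ∧ (suc e + suc e C 2 ≡ᵇ m))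
    ≡⟨ ≡.cong (λ q → 𝟙 ((e ≡ᵇ ℓ) ∧ (q ≡ᵇ m))) binomial-step ⟨
  𝟙 ((e ≡ᵇ ℓ) ∧ (suc (suc e) C 2 ≡ᵇ m))
    ≡⟨ mono≡𝟙 (suc e) (suc (suc e) C 2) (suc ℓ) m ⟨
  mono (suc e) (suc (suc e) C 2) (suc ℓ) m ∎
  where
  open ≡.≡-Reasoning
  binomial-step : suc (suc e) C 2 ≡ suc e + suc e C 2
  binomial-step = ≡.trans (≡.sym (nCk+nC[k+1]≡[n+1]C[k+1] (suc e) 1)) (≡.cong (_+ suc e C 2) (nC1≡n (suc e)))

-- Eliminating C_1, …, C_(n-1)

denom : ℕ → Series
denom zero = 1ˢ
denom (suc d) = T ⊗ X ^ˢ suc d ⊗ denom d ⊕ (Y ⊖ T ⊗ X) ⊗ Y ^ˢ d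

module _ where
  open CommutativeRing seriesRing using (_≈_; refl; sym; +-cong; +-congʳ; *-congˡ; *-comm; setoid)
  open IntegerCoefficientSolver seriesRing using (solve; _:+_; _:*_; _:-_; _:^_; _:=_)
  open import Relation.Binary.Reasoning.Setoid setoid

  denom≈Yⁿ⊖B : ∀ n → 2 ≤ n → denom n ≈ Y ^ˢ n ⊖ B n
  denom≈Yⁿ⊖B 1 (ℕ.s≤s ())
  denom≈Yⁿ⊖B 2 _ =
    solve 2 (λ t x → let 1ₑ = x :^ 0 ; y = 1ₑ :- x in
                t :* (x :* (x :* 1ₑ)) :* (t :* (x :* 1ₑ) :* 1ₑ :+ (y :- t :* x) :* 1ₑ)
                  :+ (y :- t :* x) :* (y :* 1ₑ)
             := y :* (y :* 1ₑ) :- t :* x :* (y :* (y :* 1ₑ)))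
      refl T X
  denom≈Yⁿ⊖B (suc (suc (suc k))) _ = begin
    T ⊗ Xᵏ⁺³ ⊗ denom (2 + k) ⊕ (Y ⊖ T ⊗ X) ⊗ Yᵏ⁺²
      ≈⟨ +-congʳ (*-congˡ {T ⊗ Xᵏ⁺³} (denom≈Yⁿ⊖B (suc (suc k)) (ℕ.s≤s (ℕ.s≤s ℕ.z≤n)))) ⟩
    T ⊗ Xᵏ⁺³ ⊗ (Yᵏ⁺² ⊖ B (2 + k)) ⊕ (Y ⊖ T ⊗ X) ⊗ Yᵏ⁺²
      ≈⟨ solve 5 (λ t x xᵏ⁺² yᵏ⁺² b → let 1ₑ = x :^ 0 ; y = 1ₑ :- x in
                    t :* (x :* xᵏ⁺²) :* (yᵏ⁺² :- b) :+ (y :- t :* x) :* yᵏ⁺²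
                 := y :* yᵏ⁺² :- (t :* (x :* xᵏ⁺²) :* b :+ t :* x :* yᵏ⁺² :* (1ₑ :- xᵏ⁺²)))
           refl T X (X ^ˢ (2 + k)) Yᵏ⁺² (B (2 + k)) ⟩
    Y ^ˢ (3 + k) ⊖ B (3 + k) ∎
    where
    Xᵏ⁺³ = X ^ˢ (3 + k)
    Yᵏ⁺² = Y ^ˢ (2 + k)

  module Elimination (n : ℕ) (C : ℕ → Series)
    (Y⊗C₀≈ : Y ⊗ C 0 ≈ T ⊗ X ^ˢ 1 ⊗ C 1)
    (Y⊗ΔC≈ : ∀ e → 2 + e ≤ n →
             Y ⊗ (C (1 + e) ⊖ C e) ≈ T ⊗ X ^ˢ (2 + e) ⊗ (C (2 + e) ⊖ C (1 + e)))
    where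

    wt-incr⊗ΔC : ∀ d → 1 + d ≤ n →
                 wt-incr (1 + d) ⊗ (C (1 + d) ⊖ C d) ≈ Y ^ˢ d ⊗ (Y ⊖ T ⊗ X) ⊗ C 0
    wt-incr⊗ΔC zero _ = begin
      T ⊗ X ^ˢ 1 ⊗ 1ˢ ⊗ (C 1 ⊖ C 0)
        ≈⟨ solve 4 (λ t x c₁ c₀ → let 1ₑ = x :^ 0 in
                      t :* (x :* 1ₑ) :* 1ₑ :* (c₁ :- c₀) := t :* (x :* 1ₑ) :* c₁ :- t :* x :* c₀)
             refl T X (C 1) (C 0) ⟩
      T ⊗ X ^ˢ 1 ⊗ C 1 ⊖ T ⊗ X ⊗ C 0
        ≈⟨ +-congʳ Y⊗C₀≈ ⟨
      Y ⊗ C 0 ⊖ T ⊗ X ⊗ C 0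
        ≈⟨ solve 3 (λ t x c₀ → let 1ₑ = x :^ 0 in
                      (1ₑ :- x) :* c₀ :- t :* x :* c₀ := 1ₑ :* ((1ₑ :- x) :- t :* x) :* c₀)
             refl T X (C 0) ⟩
      Y ^ˢ 0 ⊗ (Y ⊖ T ⊗ X) ⊗ C 0 ∎
    wt-incr⊗ΔC (suc e) 2+e≤n = begin
      T ⊗ Xᵉ⁺² ⊗ wt-incr (1 + e) ⊗ ΔC (1 + e)
        ≈⟨ solve 4 (λ t xᵉ⁺² w δ → t :* xᵉ⁺² :* w :* δ := w :* (t :* xᵉ⁺² :* δ))
             refl T Xᵉ⁺² (wt-incr (1 + e)) (ΔC (1 + e)) ⟩
      wt-incr (1 + e) ⊗ (T ⊗ Xᵉ⁺² ⊗ ΔC (1 + e))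
        ≈⟨ *-congˡ {wt-incr (1 + e)} (Y⊗ΔC≈ e 2+e≤n) ⟨
      wt-incr (1 + e) ⊗ (Y ⊗ ΔC e)
        ≈⟨ solve 3 (λ w y δ → w :* (y :* δ) := y :* (w :* δ)) refl (wt-incr (1 + e)) Y (ΔC e) ⟩
      Y ⊗ (wt-incr (1 + e) ⊗ ΔC e)
        ≈⟨ *-congˡ {Y} (wt-incr⊗ΔC e (ℕₚ.<⇒≤ 2+e≤n)) ⟩
      Y ⊗ (Y ^ˢ e ⊗ (Y ⊖ T ⊗ X) ⊗ C 0)
        ≈⟨ solve 5 (λ y yᵉ t x c₀ →
                      y :* (yᵉ :* (y :- t :* x) :* c₀) := y :* yᵉ :* (y :- t :* x) :* c₀)
             refl Y (Y ^ˢ e) T X (C 0) ⟩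
      Y ^ˢ (1 + e) ⊗ (Y ⊖ T ⊗ X) ⊗ C 0 ∎
      where
      Xᵉ⁺² = X ^ˢ (2 + e)
      ΔC : ℕ → Series
      ΔC d = C (1 + d) ⊖ C d

    C₀⊗denom : ∀ d → d ≤ n → C 0 ⊗ denom d ≈ wt-incr d ⊗ C d
    C₀⊗denom zero _ = *-comm (C 0) 1ˢ
    C₀⊗denom (suc e) 1+e≤n = begin
      C 0 ⊗ (T ⊗ Xᵉ⁺¹ ⊗ denom e ⊕ (Y ⊖ T ⊗ X) ⊗ Y ^ˢ e)
        ≈⟨ solve 7 (λ c₀ t xᵉ⁺¹ d y x yᵉ → c₀ :* (t :* xᵉ⁺¹ :* d :+ (y :- t :* x) :* yᵉ)
                                          := t :* xᵉ⁺¹ :* (c₀ :* d) :+ yᵉ :* (y :- t :* x) :* c₀)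
             refl (C 0) T Xᵉ⁺¹ (denom e) Y X (Y ^ˢ e) ⟩
      T ⊗ Xᵉ⁺¹ ⊗ (C 0 ⊗ denom e) ⊕ Y ^ˢ e ⊗ (Y ⊖ T ⊗ X) ⊗ C 0
        ≈⟨ +-cong (*-congˡ {T ⊗ Xᵉ⁺¹} (C₀⊗denom e (ℕₚ.<⇒≤ 1+e≤n)))
                  (sym (wt-incr⊗ΔC e 1+e≤n)) ⟩
      T ⊗ Xᵉ⁺¹ ⊗ (wt-incr e ⊗ C e) ⊕ wt-incr (1 + e) ⊗ (C (1 + e) ⊖ C e)
        ≈⟨ solve 5 (λ t xᵉ⁺¹ w cₑ cₑ₊₁ →
                      t :* xᵉ⁺¹ :* (w :* cₑ) :+ t :* xᵉ⁺¹ :* w :* (cₑ₊₁ :- cₑ) := t :* xᵉ⁺¹ :* w :* cₑ₊₁)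
             refl T Xᵉ⁺¹ (wt-incr e) (C e) (C (1 + e)) ⟩
      wt-incr (1 + e) ⊗ C (1 + e) ∎
      where
      Xᵉ⁺¹ = X ^ˢ (1 + e)

-- Counting words

countᵇ : (A → Bool) → List A → ℕ
countᵇ p [] = 0
countᵇ p (x ∷ xs) = if p x then suc (countᵇ p xs) else countᵇ p xs

length-filter≡countᵇ : ∀ {P : Pred A 0ℓ} (P? : Decidable P) xs →
                       length (filter P? xs) ≡ countᵇ (does ∘ P?) xs
length-filter≡countᵇ P? [] = ≡.refl
length-filter≡countᵇ P? (x ∷ xs) with does (P? x)
... | true = ≡.cong suc (length-filter≡countᵇ P? xs)
... | false = length-filter≡countᵇ P? xs

countᵇ-cong : ∀ {p q : A → Bool} → p ≗ q → ∀ xs → countᵇ p xs ≡ countᵇ q xs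
countᵇ-cong p≗q [] = ≡.refl
countᵇ-cong {q = q} p≗q (x ∷ xs) rewrite p≗q x with q x
... | true = ≡.cong suc (countᵇ-cong p≗q xs)
... | false = countᵇ-cong p≗q xs

countᵇ-false : ∀ xs → countᵇ (λ (_ : A) → false) xs ≡ 0
countᵇ-false [] = ≡.refl
countᵇ-false (x ∷ xs) = countᵇ-false xs

countᵇ-++ : ∀ (p : A → Bool) xs ys → countᵇ p (xs ++ ys) ≡ countᵇ p xs + countᵇ p ys
countᵇ-++ p [] ys = ≡.refl
countᵇ-++ p (x ∷ xs) ys with p x
... | true = ≡.cong suc (countᵇ-++ p xs ys)
... | false = countᵇ-++ p xs ys

countᵇ-map : ∀ (p : E → Bool) (f : A → E) xs → countᵇ p (map f xs) ≡ countᵇ (p ∘ f) xs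
countᵇ-map p f [] = ≡.refl
countᵇ-map p f (x ∷ xs) with p (f x)
... | true = ≡.cong suc (countᵇ-map p f xs)
... | false = countᵇ-map p f xs

countᵇ-concatMap : ∀ (p : E → Bool) (f : A → List E) xs →
                   countᵇ p (concatMap f xs) ≡ sum (map (countᵇ p ∘ f) xs)
countᵇ-concatMap p f [] = ≡.refl
countᵇ-concatMap p f (x ∷ xs) =
  ≡.trans (countᵇ-++ p (f x) (concatMap f xs)) (≡.cong (countᵇ p (f x) ℕ.+_) (countᵇ-concatMap p f xs))

_after_ : (Word → Bool) → ℕ → Word → Bool
(p after a) w = p (a ∷ w)

#words : (Word → Bool) → ℕ → ℕ → ℕ → ℕ
#words p ℓ M m = countᵇ (λ w → (sum w ≡ᵇ m) ∧ p w) (wordsUpTo ℓ M)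

suc+≡ᵇ : ∀ i s m → (suc i + s ≡ᵇ m) ≡ (i <ᵇ m) ∧ (s ≡ᵇ m ∸ suc i)
suc+≡ᵇ zero s zero = ≡.refl
suc+≡ᵇ zero s (suc m) = ≡.refl
suc+≡ᵇ (suc i) s zero = ≡.refl
suc+≡ᵇ (suc i) s (suc m) = suc+≡ᵇ i s m

#words-first-letter : ∀ p ℓ M m i →
  countᵇ (λ w → (sum (suc i ∷ w) ≡ᵇ m) ∧ p (suc i ∷ w)) (wordsUpTo ℓ M) ≡
  (if i <ᵇ m then #words (p after suc i) ℓ M (m ∸ suc i) else 0)
#words-first-letter p ℓ M m i = ≡.trans
  (countᵇ-cong (λ w → ≡.cong (_∧ p (suc i ∷ w)) (suc+≡ᵇ i (sum w) m)) (wordsUpTo ℓ M))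
  (by-first-test (i <ᵇ m))
  where
  by-first-test : ∀ b → countᵇ (λ w → (b ∧ (sum w ≡ᵇ m ∸ suc i)) ∧ p (suc i ∷ w)) (wordsUpTo ℓ M) ≡
                        (if b then #words (p after suc i) ℓ M (m ∸ suc i) else 0)
  by-first-test true = ≡.refl
  by-first-test false = countᵇ-false (wordsUpTo ℓ M)

#words-suc : ∀ p ℓ {M m} → m ≤ M →
             #words p (suc ℓ) M m ≡ sum (applyUpTo (λ i → #words (p after suc i) ℓ M (m ∸ suc i)) m)
#words-suc p ℓ {M} {m} m≤M = begin
  countᵇ q (concatMap (λ a → map (a ∷_) (wordsUpTo ℓ M)) (map suc (upTo M)))
    ≡⟨ countᵇ-concatMap q (λ a → map (a ∷_) (wordsUpTo ℓ M)) (map suc (upTo M)) ⟩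
  sum (map (λ a → countᵇ q (map (a ∷_) (wordsUpTo ℓ M))) (map suc (upTo M)))
    ≡⟨ ≡.cong sum (map-cong (λ a → countᵇ-map q (a ∷_) (wordsUpTo ℓ M)) (map suc (upTo M))) ⟩
  sum (map (λ a → countᵇ (q ∘ (a ∷_)) (wordsUpTo ℓ M)) (map suc (upTo M)))
    ≡⟨ ≡.cong sum (≡.trans (≡.cong (map _) (map-upTo suc M)) (map-applyUpTo suc _ M)) ⟩
  sum (applyUpTo (λ i → countᵇ (q ∘ (suc i ∷_)) (wordsUpTo ℓ M)) M)
    ≡⟨ sum-applyUpTo-cong M (λ i _ → #words-first-letter p ℓ M m i) ⟩
  sum (applyUpTo (λ i → if i <ᵇ m then term i else 0) M)
    ≡⟨ sum-applyUpTo-truncate _ m≤M (λ i m≤i → ≡.cong (if_then term i else 0)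
                                                        (dec-false (i ℕ.<? m) (ℕₚ.≤⇒≯ m≤i))) ⟩
  sum (applyUpTo (λ i → if i <ᵇ m then term i else 0) m)
    ≡⟨ sum-applyUpTo-cong m (λ i i<m → ≡.cong (if_then term i else 0) (dec-true (i ℕ.<? m) i<m)) ⟩
  sum (applyUpTo term m) ∎
  where
  open ≡.≡-Reasoning
  q : Word → Bool
  q w = (sum w ≡ᵇ m) ∧ p w
  term : ℕ → ℕ
  term i = #words (p after suc i) ℓ M (m ∸ suc i)

#words-bound : ∀ ℓ p {M m} → m ≤ M → #words p ℓ M m ≡ #words p ℓ m m
#words-bound zero p _ = ≡.refl
#words-bound (suc ℓ) p {M} {m} m≤M = begin
  #words p (suc ℓ) M m
    ≡⟨ #words-suc p ℓ m≤M ⟩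
  sum (applyUpTo (λ i → #words (p after suc i) ℓ M (m ∸ suc i)) m)
    ≡⟨ sum-applyUpTo-cong m (λ i _ → ≡.trans (bound m≤M i) (≡.sym (bound ℕₚ.≤-refl i))) ⟩
  sum (applyUpTo (λ i → #words (p after suc i) ℓ m (m ∸ suc i)) m)
    ≡⟨ #words-suc p ℓ (ℕₚ.≤-refl {m}) ⟨
  #words p (suc ℓ) m m ∎
  where
  open ≡.≡-Reasoning
  bound : ∀ {K} → m ≤ K → ∀ i →
          #words (p after suc i) ℓ K (m ∸ suc i) ≡ #words (p after suc i) ℓ (m ∸ suc i) (m ∸ suc i)
  bound m≤K i = #words-bound ℓ (p after suc i) (ℕₚ.≤-trans (ℕₚ.m∸n≤m m (suc i)) m≤K)

-- letters never exceed the letter sum, so the bound M = m restricts nothing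
#[_] : (Word → Bool) → ℕ → ℕ → ℕ
#[ p ] ℓ m = #words p ℓ m m

#-suc : ∀ p ℓ m → #[ p ] (suc ℓ) m ≡ sum (applyUpTo (λ i → #[ p after suc i ] ℓ (m ∸ suc i)) m)
#-suc p ℓ m = ≡.trans (#words-suc p ℓ (ℕₚ.≤-refl {m}))
  (sum-applyUpTo-cong m (λ i _ → #words-bound ℓ (p after suc i) (ℕₚ.m∸n≤m m (suc i))))

#-cong : ∀ {p q} → p ≗ q → ∀ ℓ m → #[ p ] ℓ m ≡ #[ q ] ℓ m
#-cong p≗q ℓ m = countᵇ-cong (λ w → ≡.cong ((sum w ≡ᵇ m) ∧_) (p≗q w)) (wordsUpTo ℓ m)

countS≡# : ∀ u ℓ m → countS u ℓ m ≡ #[ does ∘ InS? u ] ℓ m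
countS≡# u ℓ m = length-filter≡countᵇ _ (wordsUpTo ℓ m)

-- The automaton

-- the p-th letter of w, counting from 0, and 0 past the end of w
at : Word → ℕ → ℕ
at [] _ = 0
at (a ∷ w) zero = a
at (a ∷ w) (suc p) = at w p

at-drop : ∀ i w k → at (drop i w) k ≡ at w (i + k)
at-drop zero w k = ≡.refl
at-drop (suc i) [] k = ≡.refl
at-drop (suc i) (a ∷ w) k = at-drop i w k

at-beyond : ∀ w {q} → length w ≤ q → at w q ≡ 0
at-beyond [] _ = ≡.refl
at-beyond (a ∷ w) (ℕ.s≤s |w|≤q) = at-beyond w |w|≤q

PrefixDominated : Word → Word → Set
PrefixDominated u v = length u ≤ length v × Pointwise _≤_ u (take (length u) v)

prefixDominated⇒ : ∀ f n v → PrefixDominated (applyUpTo f n) v → ∀ k → k ℕ.< n → f k ≤ at v k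
prefixDominated⇒ f (suc n) (b ∷ v) (_ , fb ∷ _) zero _ = fb
prefixDominated⇒ f (suc n) (b ∷ v) (ℕ.s≤s le , _ ∷ pw) (suc k) (ℕ.s≤s k<n) =
  prefixDominated⇒ (f ∘′ suc) n v (le , pw) k k<n

prefixDominated⇐ : ∀ f → (∀ k → 1 ≤ f k) → ∀ n v → (∀ k → k ℕ.< n → f k ≤ at v k) →
                   PrefixDominated (applyUpTo f n) v
prefixDominated⇐ f f>0 zero v _ = ℕ.z≤n , []
prefixDominated⇐ f f>0 (suc n) [] f≤v with () ← ℕₚ.≤-trans (f>0 0) (f≤v 0 (ℕ.s≤s ℕ.z≤n))
prefixDominated⇐ f f>0 (suc n) (b ∷ v) f≤v
  with le , pw ← prefixDominated⇐ (f ∘′ suc) (λ k → f>0 (suc k)) n v (λ k k<n → f≤v (suc k) (ℕ.s≤s k<n))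
  = ℕ.s≤s le , f≤v 0 (ℕ.s≤s ℕ.z≤n) ∷ pw

length-drop⇒ : ∀ i L (xs : List A) → i + L ≤ length xs → L ≤ length (drop i xs)
length-drop⇒ zero L xs le = le
length-drop⇒ (suc i) L (x ∷ xs) (ℕ.s≤s le) = length-drop⇒ i L xs le

length-drop⇐ : ∀ i L (xs : List A) → 1 ≤ L → L ≤ length (drop i xs) → i + L ≤ length xs
length-drop⇐ zero L xs _ le = le
length-drop⇐ (suc i) (suc L) [] _ ()
length-drop⇐ (suc i) L (x ∷ xs) L>0 le = ℕ.s≤s (length-drop⇐ i L xs L>0 le)

does≡ : ∀ {P : Set} (P? : Dec P) b → (P → Tᵇ b) → (Tᵇ b → P) → does P? ≡ b
does≡ P? true _ T⇒P = dec-true P? (T⇒P tt)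
does≡ P? false P⇒T _ = dec-false P? P⇒T

module IncreasingPattern (n : ℕ) (n>0 : 0 ℕ.< n) where

  accepts : ℕ → Word → Bool
  accepts d [] = n ≤ᵇ d
  accepts d (a ∷ w) = (d <ᵇ n) ∧ accepts (suc d ⊓ a) w

  -- state 0 w p is the largest j such that 12⋯j embeds into w ending just before position p
  state : ℕ → Word → ℕ → ℕ
  state d w zero = d
  state d w (suc p) = suc (state d w p) ⊓ at w p

  state-∷ : ∀ d a w p → state d (a ∷ w) (suc p) ≡ state (suc d ⊓ a) w p
  state-∷ d a w zero = ≡.refl
  state-∷ d a w (suc p) = ≡.cong (λ s → suc s ⊓ at w p) (state-∷ d a w p)

  Accepts : ℕ → Word → Set
  Accepts d w = n ≤ state d w (length w) × (∀ p → p ℕ.< length w → state d w p ℕ.< n)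

  accepts⇒Accepts : ∀ d w → Tᵇ (accepts d w) → Accepts d w
  accepts⇒Accepts d [] n≤d = ℕₚ.≤ᵇ⇒≤ n d n≤d , λ _ ()
  accepts⇒Accepts d (a ∷ w) acc with d<n , acc′ ← Equivalence.to T-∧ acc
    with final , before ← accepts⇒Accepts (suc d ⊓ a) w acc′ =
    ≡.subst (n ≤_) (≡.sym (state-∷ d a w (length w))) final ,
    λ { zero _ → ℕₚ.<ᵇ⇒< d n d<n
      ; (suc p) (ℕ.s≤s p<|w|) → ≡.subst (ℕ._< n) (≡.sym (state-∷ d a w p)) (before p p<|w|) }

  Accepts⇒accepts : ∀ d w → Accepts d w → Tᵇ (accepts d w)
  Accepts⇒accepts d [] (n≤d , _) = ℕₚ.≤⇒≤ᵇ n≤d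
  Accepts⇒accepts d (a ∷ w) (final , before) = Equivalence.from T-∧
    ( ℕₚ.<⇒<ᵇ (before 0 (ℕ.s≤s ℕ.z≤n))
    , Accepts⇒accepts (suc d ⊓ a) w
        ( ≡.subst (n ≤_) (state-∷ d a w (length w)) final
        , λ p p<|w| → ≡.subst (ℕ._< n) (state-∷ d a w p) (before (suc p) (ℕ.s≤s p<|w|)) ) )

  state-≤ : ∀ w p → state 0 w p ≤ p
  state-≤ w zero = ℕ.z≤n
  state-≤ w (suc p) = ℕₚ.≤-trans (ℕₚ.m⊓n≤m _ _) (ℕ.s≤s (state-≤ w p))

  state-beyond : ∀ w q → length w ≤ q → state 0 w (suc q) ≡ 0
  state-beyond w q |w|≤q rewrite at-beyond w |w|≤q = ℕₚ.⊓-zeroʳ (suc (state 0 w q))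

  ≤state⇒staircase : ∀ w s j → j ≤ state 0 w (s + j) → ∀ k → k ℕ.< j → suc k ≤ at w (s + k)
  ≤state⇒staircase w s (suc j) j<state k k<1+j rewrite ℕₚ.+-suc s j
    with ℕₚ.m<1+n⇒m<n∨m≡n k<1+j
  ... | inj₁ k<j =
    ≤state⇒staircase w s j (ℕₚ.≤-pred (ℕₚ.m≤n⊓o⇒m≤n (suc (state 0 w (s + j))) _ j<state)) k k<j
  ... | inj₂ ≡.refl = ℕₚ.m≤n⊓o⇒m≤o (suc (state 0 w (s + k))) _ j<state

  staircase⇒≤state : ∀ w s j → (∀ k → k ℕ.< j → suc k ≤ at w (s + k)) → j ≤ state 0 w (s + j)
  staircase⇒≤state w s zero _ = ℕ.z≤n
  staircase⇒≤state w s (suc j) stairs rewrite ℕₚ.+-suc s j =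
    ℕₚ.⊓-glb (ℕ.s≤s (staircase⇒≤state w s j (λ k k<j → stairs k (ℕₚ.m≤n⇒m≤1+n k<j))))
             (stairs j ℕₚ.≤-refl)

  length-incr : length (incr n) ≡ n
  length-incr = ≡.trans (length-map suc (upTo n)) (length-upTo n)

  embedsAt⇔n≤state : ∀ w i → EmbedsAt (incr n) w i ⇔ n ≤ state 0 w (i + n)
  embedsAt⇔n≤state w i = mk⇔ to from
    where
    incr≡ : incr n ≡ applyUpTo suc n
    incr≡ = map-upTo suc n

    to : EmbedsAt (incr n) w i → n ≤ state 0 w (i + n)
    to emb with le , pw ← ≡.subst (λ u → EmbedsAt u w i) incr≡ emb =
      staircase⇒≤state w i n λ k k<n →
        ≡.subst (suc k ≤_) (at-drop i w k)
          (prefixDominated⇒ suc n (drop i w) (length-drop⇒ i (length (applyUpTo suc n)) w le , pw) k k<n)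

    from : n ≤ state 0 w (i + n) → EmbedsAt (incr n) w i
    from n≤state
      with le , pw ← prefixDominated⇐ suc (λ _ → ℕ.s≤s ℕ.z≤n) n (drop i w) (λ k k<n →
                       ≡.subst (suc k ≤_) (≡.sym (at-drop i w k)) (≤state⇒staircase w i n n≤state k k<n))
      = ≡.subst (λ u → EmbedsAt u w i) (≡.sym incr≡)
          (length-drop⇐ i _ w (≡.subst (1 ≤_) (≡.sym (length-applyUpTo suc n)) n>0) le , pw)

  n≰state-beyond : ∀ w q → length w ℕ.< q → ¬ n ≤ state 0 w q
  n≰state-beyond w (suc q) (ℕ.s≤s |w|≤q) n≤state =
    ℕₚ.<⇒≱ n>0 (≡.subst (n ≤_) (state-beyond w q |w|≤q) n≤state)

  InS⇔Accepts : ∀ w → InS (incr n) w ⇔ Accepts 0 w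
  InS⇔Accepts w = mk⇔ to from
    where
    p∸n+n≡p : ∀ {p} → n ≤ state 0 w p → p ∸ n + n ≡ p
    p∸n+n≡p {p} n≤state = ℕₚ.m∸n+n≡m (ℕₚ.≤-trans n≤state (state-≤ w p))

    n≤state⇒embeds : ∀ {p} → n ≤ state 0 w p → EmbedsAt (incr n) w (p ∸ n)
    n≤state⇒embeds {p} n≤state = Equivalence.from (embedsAt⇔n≤state w (p ∸ n))
      (≡.subst (λ q → n ≤ state 0 w q) (≡.sym (p∸n+n≡p n≤state)) n≤state)

    Suffix = ∀ i → EmbedsAt (incr n) w i → i + length (incr n) ≡ length w

    ends-at-end : ∀ {i} → Suffix → EmbedsAt (incr n) w i → i + n ≡ length w
    ends-at-end {i} suffix emb = ≡.trans (≡.cong (i ℕ.+_) (≡.sym length-incr)) (suffix i emb)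

    to : InS (incr n) w → Accepts 0 w
    to ((i , emb) , suffix) =
      ≡.subst (λ q → n ≤ state 0 w q) (ends-at-end suffix emb) (Equivalence.to (embedsAt⇔n≤state w i) emb) ,
      λ p p<|w| → ℕₚ.≰⇒> λ n≤state →
        ℕₚ.<-irrefl (≡.trans (≡.sym (p∸n+n≡p n≤state)) (ends-at-end suffix (n≤state⇒embeds n≤state)))
                    p<|w|

    from : Accepts 0 w → InS (incr n) w
    from (final , before) = (length w ∸ n , n≤state⇒embeds final) , suffix
      where
      n≤state⇒end : ∀ q → n ≤ state 0 w q → q ≡ length w
      n≤state⇒end q n≤state with ℕₚ.<-cmp q (length w)
      ... | tri< q<|w| _ _ = contradiction (before q q<|w|) (ℕₚ.≤⇒≯ n≤state)
      ... | tri≈ _ q≡|w| _ = q≡|w|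
      ... | tri> _ _ |w|<q = contradiction n≤state (n≰state-beyond w q |w|<q)

      suffix : Suffix
      suffix i emb = ≡.trans (≡.cong (i ℕ.+_) length-incr)
                             (n≤state⇒end (i + n) (Equivalence.to (embedsAt⇔n≤state w i) emb))

  InS?≡accepts : ∀ w → does (InS? (incr n) w) ≡ accepts 0 w
  InS?≡accepts w = does≡ (InS? (incr n) w) (accepts 0 w)
    (Accepts⇒accepts 0 w ∘′ Equivalence.to (InS⇔Accepts w))
    (Equivalence.from (InS⇔Accepts w) ∘′ accepts⇒Accepts 0 w)

  -- the words which, read from state d, first reach state n at their end
  C : ℕ → Series
  C d ℓ m = + #[ accepts d ] ℓ m

  S≈C₀ : S (incr n) ≈ˢ C 0
  S≈C₀ ℓ m = ≡.cong +_ (≡.trans (countS≡# (incr n) ℓ m) (#-cong InS?≡accepts ℓ m))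

  C-zero : ∀ {d} → d ℕ.< n → ∀ m → C d 0 m ≡ + 0
  C-zero {d} d<n zero = ≡.cong (λ b → + (if b then 1 else 0)) (dec-false (n ℕ.≤? d) (ℕₚ.<⇒≱ d<n))
  C-zero d<n (suc m) = ≡.refl

  Cₙ≈1 : C n ≈ˢ 1ˢ
  Cₙ≈1 zero zero = ≡.cong (λ b → + (if b then 1 else 0)) (dec-true (n ℕ.≤? n) ℕₚ.≤-refl)
  Cₙ≈1 zero (suc m) = ≡.refl
  Cₙ≈1 (suc ℓ) m =
    ≡.cong +_ (≡.trans (#-suc (accepts n) ℓ m) (sum-applyUpTo-truncate {m} _ ℕ.z≤n λ i _ → none i))
    where
    n≮n : (n <ᵇ n) ≡ false
    n≮n = dec-false (n ℕ.<? n) (ℕₚ.<-irrefl ≡.refl)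
    none : ∀ i → #[ accepts n after suc i ] ℓ (m ∸ suc i) ≡ 0
    none i =
      ≡.trans (countᵇ-cong rejects (wordsUpTo ℓ (m ∸ suc i))) (countᵇ-false (wordsUpTo ℓ (m ∸ suc i)))
      where
      rejects : ∀ w → (sum w ≡ᵇ m ∸ suc i) ∧ (accepts n after suc i) w ≡ false
      rejects w = ≡.trans (≡.cong (λ b → (sum w ≡ᵇ m ∸ suc i) ∧ (b ∧ accepts (suc (n ⊓ i)) w)) n≮n)
                          (∧-zeroʳ (sum w ≡ᵇ m ∸ suc i))

  C-suc : ∀ {d} → d ℕ.< n → ∀ ℓ m →
          C d (suc ℓ) m ≡ sumℤ (applyUpTo (λ i → C (suc (d ⊓ i)) ℓ (m ∸ suc i)) m)
  C-suc {d} d<n ℓ m = begin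
    + #[ accepts d ] (suc ℓ) m
      ≡⟨ ≡.cong +_ (#-suc (accepts d) ℓ m) ⟩
    + sum (applyUpTo (λ i → #[ accepts d after suc i ] ℓ (m ∸ suc i)) m)
      ≡⟨ ≡.cong +_ (sum-applyUpTo-cong m λ i _ → #-cong (first-step i) ℓ (m ∸ suc i)) ⟩
    + sum (applyUpTo #next m)
      ≡⟨ ≡.trans (+-sum (applyUpTo #next m)) (≡.cong sumℤ (map-applyUpTo #next +_ m)) ⟩
    sumℤ (applyUpTo (λ i → C (suc (d ⊓ i)) ℓ (m ∸ suc i)) m) ∎
    where
    open ≡.≡-Reasoning
    first-step : ∀ i → accepts d after suc i ≗ accepts (suc (d ⊓ i))
    first-step i w = ≡.cong (_∧ accepts (suc (d ⊓ i)) w) (dec-true (d ℕ.<? n) d<n)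
    #next : ℕ → ℕ
    #next i = #[ accepts (suc (d ⊓ i)) ] ℓ (m ∸ suc i)

  min-difference : ∀ (c : ℕ → ℤ) e i →
                   c (suc (suc e ⊓ i)) ℤ.- c (suc (e ⊓ i)) ≡ [ suc e ≤ i ]· (c (2 + e) ℤ.- c (1 + e))
  min-difference c zero zero = ℤ.+-inverseʳ (c 1)
  min-difference c (suc e) zero = ℤ.+-inverseʳ (c 1)
  min-difference c zero (suc i) = ≡.refl
  min-difference c (suc e) (suc i) = min-difference (c ∘′ suc) e i

  Y⊗C₀ : Y ⊗ C 0 ≈ˢ T ⊗ X ^ˢ 1 ⊗ C 1
  Y⊗C₀ = Y⊗-tailSum 0 (C 0) (C 1) (C-zero n>0) (C-suc n>0)

  Y⊗ΔC : ∀ e → 2 + e ≤ n → Y ⊗ (C (1 + e) ⊖ C e) ≈ˢ T ⊗ X ^ˢ (2 + e) ⊗ (C (2 + e) ⊖ C (1 + e))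
  Y⊗ΔC e 2+e≤n = Y⊗-tailSum (1 + e) (C (1 + e) ⊖ C e) (C (2 + e) ⊖ C (1 + e))
    (λ m → ≡.cong₂ ℤ._-_ (C-zero 2+e≤n m) (C-zero 1+e≤n m))
    (λ ℓ m → ≡.trans (≡.cong₂ ℤ._-_ (C-suc 2+e≤n ℓ m) (C-suc 1+e≤n ℓ m))
              (≡.trans (sumℤ-applyUpTo-− m _ _)
                (≡.cong sumℤ (applyUpTo-cong m (λ i _ → min-difference (λ d → C d ℓ (m ∸ suc i)) e i)))))
    where
    1+e≤n = ℕₚ.<⇒≤ 2+e≤n

theorem6p1 : (n : ℕ) → 2 ≤ n → (ℓ m : ℕ) →
    (S (incr n) ⊗ ((1ˢ ⊖ X) ^ˢ n ⊖ B n)) ℓ m ≡ mono n (suc n C 2) ℓ m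
theorem6p1 n 2≤n ℓ m = ≡.trans (S⊗[Yⁿ⊖B]≈wt-incr ℓ m) (wt-incr≈mono n ℓ m)
  where
  open IncreasingPattern n (ℕₚ.≤-trans (ℕ.s≤s ℕ.z≤n) 2≤n)
  open Elimination n C Y⊗C₀ Y⊗ΔC
  open CommutativeRing seriesRing using (_≈_; setoid; *-cong; *-congˡ; *-identityʳ; sym)
  open import Relation.Binary.Reasoning.Setoid setoid

  S⊗[Yⁿ⊖B]≈wt-incr : S (incr n) ⊗ (Y ^ˢ n ⊖ B n) ≈ wt-incr n
  S⊗[Yⁿ⊖B]≈wt-incr = begin
    S (incr n) ⊗ (Y ^ˢ n ⊖ B n)  ≈⟨ *-cong S≈C₀ (sym (denom≈Yⁿ⊖B n 2≤n)) ⟩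
    C 0 ⊗ denom n                ≈⟨ C₀⊗denom n ℕₚ.≤-refl ⟩
    wt-incr n ⊗ C n              ≈⟨ *-congˡ {wt-incr n} Cₙ≈1 ⟩
    wt-incr n ⊗ 1ˢ               ≈⟨ *-identityʳ (wt-incr n) ⟩
    wt-incr n                    ∎
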